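{- Let $k,N$ be positive integers, $n=(8k+4)N+1$, and let $d$ be an integer with $d\equiv N\pmod 2$ and $d\in(N/3-N/(48k+15),\,N/3)$; let $e=(N-d)/2$. For $i\in[1,d]$ let \[ S_{d,i}=\{i,\,d+i,\,2d+i,\dots,(4k-1)d+i\}\cup\{4kN+4e+i,\ (4k+2)N-i+1\}, \] and let $C'(S_{d,i})=(c_0,c_1,\dots,c_{4k+1})$ where $c_{2j}=jd$, $c_{2j+1}=-jd-i$ for $0\le j\le k$; $c_{2j}=(j+1)d$, $c_{2j+1}=-jd-i$ for $k+1\le j\le 2k-1$; and $c_{4k}=(4k+2)N-(2k+1)d$, $c_{4k+1}=-(2k+1)d-i$. That is, $C'(S_{d,i})=(0,-i,d,-d-i,\dots,kd,-kd-i,(k+2)d,-(k+1)d-i,(k+3)d,-(k+2)d-i,\dots,2kd,-(2k-1)d-i,(4k+2)N-(2k+1)d,-(2k+1)d-i)$. Then, working modulo $n$, $C'(S_{d,i})$ is a $(4k+2)$-cycle whose set of edge differences is $S_{d,i}$.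
   Context: $[a,b]$ denotes $\{a,\dots,b\}$. The vertices of $K_n$ are $\mathbb{Z}_n$ ($n$ odd); the difference of an edge $\{a,b\}$ is the minimum of $(a-b)\bmod n$ and $(b-a)\bmod n$ (taken in $[0,n-1]$). The difference set of a cycle is the multiset of differences of its edges. -}

module Defs where

open import Data.Nat as ℕ using (ℕ; suc)
open import Data.Integer as ℤ using (ℤ; +_; -_; _-_)
open import Data.Integer.DivMod using (_%ℕ_)
open import Data.List using (List; []; _∷_; _++_; [_]; map; zipWith; concatMap; upTo; applyUpTo; length)
open import Data.List.Relation.Unary.Unique.Propositional using (Unique)
open import Data.Product using (_×_)
open import Data.Bool using (true; false)

-- n = (8k+4)N + 1 ; vertices of K_n are Z_n, represented by ℤ reduced mod n
order : ℕ → ℕ → ℕ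
order k N = suc ((8 ℕ.* k ℕ.+ 4) ℕ.* N)

res : ℕ → ℕ → ℤ → ℕ
res k N a = a %ℕ order k N

edgeDiff : ℕ → ℕ → ℤ → ℤ → ℕ
edgeDiff k N a b = ℕ._⊓_ (res k N (a - b)) (res k N (b - a))

rotate : List ℤ → List ℤ
rotate []       = []
rotate (x ∷ xs) = xs ++ [ x ]

-- difference multiset (as a list) of the closed walk c_0 c_1 ... c_{m-1} c_0
diffList : ℕ → ℕ → List ℤ → List ℕ
diffList k N cs = zipWith (edgeDiff k N) cs (rotate cs)

-- a cycle in K_n given by its vertex sequence: at least 3 vertices, pairwise distinct mod n
IsCycle : ℕ → ℕ → List ℤ → Set
IsCycle k N cs = (3 ℕ.≤ length cs) × Unique (map (res k N) cs)

cEven : ℕ → ℕ → ℤ → ℕ → ℤ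
cEven k N d j with j ℕ.≤ᵇ k | j ℕ.≤ᵇ (2 ℕ.* k ℕ.∸ 1)
... | true  | _     = + j ℤ.* d
... | false | true  = + (j ℕ.+ 1) ℤ.* d
... | false | false = + ((4 ℕ.* k ℕ.+ 2) ℕ.* N) - + (2 ℕ.* k ℕ.+ 1) ℤ.* d

cOdd : ℕ → ℤ → ℤ → ℕ → ℤ
cOdd k d i j with j ℕ.≤ᵇ (2 ℕ.* k ℕ.∸ 1)
... | true  = - (+ j ℤ.* d) - i
... | false = - (+ (2 ℕ.* k ℕ.+ 1) ℤ.* d) - i

C' : ℕ → ℕ → ℤ → ℤ → List ℤ
C' k N d i = concatMap (λ j → cEven k N d j ∷ cOdd k d i j ∷ []) (upTo (2 ℕ.* k ℕ.+ 1))

S : ℕ → ℕ → ℤ → ℤ → ℤ → List ℤ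
S k N d e i = applyUpTo (λ j → + j ℤ.* d ℤ.+ i) (4 ℕ.* k)
  ++ (+ (4 ℕ.* k ℕ.* N) ℤ.+ + 4 ℤ.* e ℤ.+ i)
  ∷ (+ ((4 ℕ.* k ℕ.+ 2) ℕ.* N) - i ℤ.+ + 1) ∷ []

-- Write the vertices of C'(S_{d,i}) as p₀, −q₀, p₁, −q₁, …, p_{2k}, −q_{2k} with p_j ≥ 0 and q_j ≥ i ≥ 1.
-- Every edge then joins a non-negative vertex to a negative one, so its difference in ℤ_n is that of
-- the sum s = |u| + |v| of the absolute values of its ends: s itself when s ≤ (n − 1)/2, and n − s otherwise.
-- Going round the cycle these sums are t·d + i for t ≤ 2k, then t·d + i for 2k + 2 ≤ t ≤ 4k − 1,
-- then q_{2k−1} + p_{2k} = 4kN + 4e + i, p_{2k} + q_{2k} = (4k+2)N + i (whose difference is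
-- (4k+2)N − i + 1), and finally q_{2k} + p₀ = (2k+1)d + i: a rearrangement of S_{d,i}.
-- The vertices are distinct mod n because the p_j increase from 0 to p_{2k}, the q_j increase from i to
-- q_{2k}, and p_{2k} + q_{2k} < n.

module Submission where

open import Defs
open import Data.Nat as ℕ using (ℕ)
open import Data.Integer as ℤ using (ℤ; +_; _-_)
open import Data.Integer.Divisibility using (_∣_)
open import Data.Rational as ℚ using (ℚ; _/_)
open import Data.List using (map)
open import Data.List.Relation.Binary.Permutation.Propositional using (_↭_)
open import Data.Product using (_×_)
open import Relation.Binary.PropositionalEquality using (_≡_)

open import Data.Empty using (⊥-elim)
import Data.Integer.Properties as ℤP
import Data.Integer.Tactic.RingSolver as ℤSolver
import Data.Nat.Properties as ℕP
open import Relation.Binary.PropositionalEquality using (_≢_; sym; trans; cong; subst₂)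

-- ℕ's operators are opened only inside this module: next to ℤ's +_, the `map +_` in the statement of
-- lemma14 would otherwise be ambiguous.
module _ where
  open import Data.Bool using (true; false)
  open import Data.Integer using (-_)
  open import Data.Integer.GCD using (gcd)
  open import Data.List using (List; []; _∷_; _++_; [_]; _∷ʳ_; concat; concatMap; applyUpTo; upTo; zipWith)
  open import Data.List.Properties using (map-applyUpTo; applyUpTo-∷ʳ; concatMap-++; ++-assoc; map-++)
  open import Data.List.Relation.Unary.All as All using (All; []; _∷_)
  import Data.List.Relation.Unary.All.Properties as AllP
  open import Data.List.Relation.Unary.AllPairs using (AllPairs; []; _∷_)
  import Data.List.Relation.Unary.AllPairs.Properties as AllPairsP
  open import Data.List.Relation.Unary.Unique.Propositional using (Unique)
  open import Data.List.Relation.Binary.Permutation.Propositional using (↭-sym; module PermutationReasoning)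
  import Data.List.Relation.Binary.Permutation.Propositional.Properties as ↭P
  open import Data.Nat using (zero; suc; _+_; _*_; _∸_; _≤_; _<_; _⊓_; z≤n; s≤s; NonZero)
  open import Data.Nat.DivMod using (m<n⇒m%n≡m)
  import Data.Nat.GCD as ℕGCD
  open import Data.Nat.Tactic.RingSolver using (solve-∀)
  open import Data.Product using (_,_)
  open import Data.Rational using (↥_; ↧_)
  import Data.Rational.Properties as ℚP
  open import Data.Sum using (inj₂)
  open import Function using (id; _∘_)
  open import Relation.Binary.PropositionalEquality using (refl; cong₂; subst; module ≡-Reasoning)

  applyUpTo-cong : ∀ {A : Set} {f g : ℕ → A} m → (∀ {j} → j < m → f j ≡ g j) → applyUpTo f m ≡ applyUpTo g m
  applyUpTo-cong zero    f≡g = refl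
  applyUpTo-cong (suc m) f≡g = cong₂ _∷_ (f≡g (s≤s z≤n)) (applyUpTo-cong m (f≡g ∘ s≤s))

  applyUpTo-+ : ∀ {A : Set} (f : ℕ → A) m n → applyUpTo f (m + n) ≡ applyUpTo f m ++ applyUpTo (λ j → f (m + j)) n
  applyUpTo-+ f zero    n = refl
  applyUpTo-+ f (suc m) n = cong (f 0 ∷_) (applyUpTo-+ (f ∘ suc) m n)

  concatMap-applyUpTo-cong : ∀ {A B C : Set} (g : A → List C) (h : B → List C) {f₁ : ℕ → A} {f₂ : ℕ → B} m
    → (∀ {j} → j < m → g (f₁ j) ≡ h (f₂ j)) → concatMap g (applyUpTo f₁ m) ≡ concatMap h (applyUpTo f₂ m)
  concatMap-applyUpTo-cong g h {f₁} {f₂} m gf≡hf = begin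
    concat (map g (applyUpTo f₁ m))  ≡⟨ cong concat (map-applyUpTo f₁ g m) ⟩
    concat (applyUpTo (g ∘ f₁) m)    ≡⟨ cong concat (applyUpTo-cong m gf≡hf) ⟩
    concat (applyUpTo (h ∘ f₂) m)    ≡⟨ cong concat (map-applyUpTo f₂ h m) ⟨
    concat (map h (applyUpTo f₂ m))  ∎
    where open ≡-Reasoning

  ∷ʳ-↭-insert : ∀ {A : Set} (xs ys zs : List A) c → xs ++ ys ++ zs ∷ʳ c ↭ (xs ++ c ∷ ys) ++ zs
  ∷ʳ-↭-insert xs ys zs c = begin
    xs ++ ys ++ zs ∷ʳ c     ≡⟨ cong (xs ++_) (++-assoc ys zs [ c ]) ⟨
    xs ++ (ys ++ zs) ∷ʳ c   ↭⟨ ↭P.++⁺ˡ xs (↭-sym (↭P.∷↭∷ʳ c (ys ++ zs))) ⟩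
    xs ++ c ∷ ys ++ zs      ≡⟨ ++-assoc xs (c ∷ ys) zs ⟨
    (xs ++ c ∷ ys) ++ zs    ∎
    where open PermutationReasoning

  -- Closed zigzag walks

  signedPair : ℕ × ℕ → List ℤ
  signedPair (p , q) = + p ∷ - + q ∷ []

  zigzag : List (ℕ × ℕ) → List ℤ
  zigzag = concatMap signedPair

  adjacentSums : ℕ → List (ℕ × ℕ) → List ℕ
  adjacentSums q []             = []
  adjacentSums q ((p , q′) ∷ L) = p + q ∷ p + q′ ∷ adjacentSums q′ L

  lastSnd : ℕ → List (ℕ × ℕ) → ℕ
  lastSnd q []             = q
  lastSnd q ((_ , q′) ∷ L) = lastSnd q′ L

  adjacentSums-++ : ∀ q L M → adjacentSums q (L ++ M) ≡ adjacentSums q L ++ adjacentSums (lastSnd q L) M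
  adjacentSums-++ q []             M = refl
  adjacentSums-++ q ((p , q′) ∷ L) M = cong (λ s → p + q ∷ p + q′ ∷ s) (adjacentSums-++ q′ L M)

  lastSnd-++ : ∀ q L M → lastSnd q (L ++ M) ≡ lastSnd (lastSnd q L) M
  lastSnd-++ q []             M = refl
  lastSnd-++ q ((_ , q′) ∷ L) M = lastSnd-++ q′ L M

  edgeLength : ℕ → ℕ → ℕ → ℕ
  edgeLength k N s = res k N (+ s) ⊓ res k N (- + s)

  module _ (k N : ℕ) where

    edgeDiff-pos-neg : ∀ p q → edgeDiff k N (+ p) (- + q) ≡ edgeLength k N (p + q)
    edgeDiff-pos-neg p q = cong₂ (λ a b → res k N a ⊓ res k N b)
      (cong (ℤ._+_ (+ p)) (ℤP.neg-involutive (+ q)))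
      (trans (sym (ℤP.neg-distrib-+ (+ q) (+ p))) (cong (λ s → - + s) (ℕP.+-comm q p)))

    edgeDiff-neg-pos : ∀ p q → edgeDiff k N (- + q) (+ p) ≡ edgeLength k N (p + q)
    edgeDiff-neg-pos p q = trans (ℕP.⊓-comm _ _) (edgeDiff-pos-neg p q)

    pathDiffs : ∀ q L p₀ → zipWith (edgeDiff k N) (- + q ∷ zigzag L) (zigzag L ∷ʳ + p₀)
      ≡ map (edgeLength k N) (adjacentSums q L ∷ʳ (p₀ + lastSnd q L))
    pathDiffs q []             p₀ = cong [_] (edgeDiff-neg-pos p₀ q)
    pathDiffs q ((p , q′) ∷ L) p₀ =
      cong₂ _∷_ (edgeDiff-neg-pos p q) (cong₂ _∷_ (edgeDiff-pos-neg p q′) (pathDiffs q′ L p₀))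

    diffList-zigzag : ∀ p q L → diffList k N (zigzag ((p , q) ∷ L))
      ≡ map (edgeLength k N) (p + q ∷ adjacentSums q L ∷ʳ (p + lastSnd q L))
    diffList-zigzag p q L = cong₂ _∷_ (edgeDiff-pos-neg p q) (pathDiffs q L p)

  -- Residues modulo n = 2 · half + 1

  half : ℕ → ℕ → ℕ
  half k N = (4 * k + 2) * N

  order≡ : ∀ k N → order k N ≡ suc (half k N + half k N)
  order≡ k N = cong suc (lemma k N)
    where
    lemma : ∀ k N → (8 * k + 4) * N ≡ (4 * k + 2) * N + (4 * k + 2) * N
    lemma = solve-∀

  module _ {k N : ℕ} where

    res-pos : ∀ {p} → p < order k N → res k N (+ p) ≡ p
    res-pos = m<n⇒m%n≡m

    res-neg : ∀ {q} → 1 ≤ q → q < order k N → res k N (- + q) ≡ order k N ∸ q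
    res-neg {suc q} _ q<n rewrite m<n⇒m%n≡m q<n = refl

    ≤half⇒<order : ∀ {s} → s ≤ half k N → s < order k N
    ≤half⇒<order {s} s≤h = subst (s <_) (sym (order≡ k N)) (s≤s (ℕP.≤-trans s≤h (ℕP.m≤m+n _ _)))

    edgeLength-≤half : ∀ {s} → 1 ≤ s → s ≤ half k N → edgeLength k N s ≡ s
    edgeLength-≤half {s} 1≤s s≤h = begin
      res k N (+ s) ⊓ res k N (- + s)  ≡⟨ cong₂ _⊓_ (res-pos s<n) (res-neg 1≤s s<n) ⟩
      s ⊓ (order k N ∸ s)              ≡⟨ ℕP.m≤n⇒m⊓n≡m (ℕP.m+n≤o⇒m≤o∸n s s+s≤n) ⟩
      s                                ∎
      where
      open ≡-Reasoning
      s<n = ≤half⇒<order s≤h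
      s+s≤n : s + s ≤ order k N
      s+s≤n = subst (s + s ≤_) (sym (order≡ k N)) (ℕP.m≤n⇒m≤1+n (ℕP.+-mono-≤ s≤h s≤h))

    edgeLength->half : ∀ {s} → half k N < s → s < order k N → edgeLength k N s ≡ order k N ∸ s
    edgeLength->half {s} h<s s<n = begin
      res k N (+ s) ⊓ res k N (- + s)  ≡⟨ cong₂ _⊓_ (res-pos s<n) (res-neg (ℕP.≤-trans (s≤s z≤n) h<s) s<n) ⟩
      s ⊓ (order k N ∸ s)              ≡⟨ ℕP.m≥n⇒m⊓n≡n (ℕP.m≤n+o⇒m∸n≤o (order k N) s n≤s+s) ⟩
      order k N ∸ s                    ∎
      where
      open ≡-Reasoning
      n≤s+s : order k N ≤ s + s
      n≤s+s = subst (_≤ s + s) (sym (order≡ k N)) (ℕP.+-mono-≤ h<s (ℕP.<⇒≤ h<s))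

  _⊏_ : ℕ × ℕ → ℕ × ℕ → Set
  (p , q) ⊏ (p′ , q′) = p < p′ × q < q′

  InBox : ℕ → ℕ → ℕ × ℕ → Set
  InBox X Y (p , q) = p ≤ X × 1 ≤ q × q ≤ Y

  residues : ℕ → List (ℕ × ℕ) → List ℕ
  residues n = concatMap (λ (p , q) → p ∷ n ∸ q ∷ [])

  map-res-zigzag : ∀ {k N X Y L} → X + Y < order k N → All (InBox X Y) L
    → map (res k N) (zigzag L) ≡ residues (order k N) L
  map-res-zigzag X+Y<n [] = refl
  map-res-zigzag {k} {N} {X} {Y} {(p , q) ∷ L} X+Y<n ((p≤X , 1≤q , q≤Y) ∷ boxes) =
    cong₂ _∷_ (res-pos {k} {N} (ℕP.≤-<-trans p≤X X<n))
      (cong₂ _∷_ (res-neg {k} {N} 1≤q (ℕP.≤-<-trans q≤Y Y<n)) (map-res-zigzag {k} {N} X+Y<n boxes))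
    where
    X<n = ℕP.≤-<-trans (ℕP.m≤m+n X Y) X+Y<n
    Y<n = ℕP.≤-<-trans (ℕP.m≤n+m Y X) X+Y<n

  module _ {n X Y : ℕ} (X+Y<n : X + Y < n) where

    private
      below : ∀ {p q} → p ≤ X → q ≤ Y → p < n ∸ q
      below {p} p≤X q≤Y = ℕP.m+n≤o⇒m≤o∸n (suc p) (ℕP.≤-trans (s≤s (ℕP.+-mono-≤ p≤X q≤Y)) X+Y<n)

      All-residues : ∀ {P : ℕ → Set} {L} → All (λ (p , q) → P p × P (n ∸ q)) L → All P (residues n L)
      All-residues = AllP.concat⁺ ∘ AllP.map⁺ ∘ All.map (λ (Pp , Pq) → Pp ∷ Pq ∷ [])

    residues-unique : ∀ {L} → AllPairs _⊏_ L → All (InBox X Y) L → Unique (residues n L)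
    residues-unique [] [] = []
    residues-unique {(p , q) ∷ L} (later ∷ increasing) ((p≤X , _ , q≤Y) ∷ boxes) =
      (ℕP.<⇒≢ (below p≤X q≤Y) ∷ All-residues (All.zipWith fromP (later , boxes)))
      ∷ All-residues (All.zipWith fromQ (later , boxes))
      ∷ residues-unique increasing boxes
      where
      fromP : ∀ {x} → (p , q) ⊏ x × InBox X Y x → let (p′ , q′) = x in p ≢ p′ × p ≢ n ∸ q′
      fromP ((p<p′ , _) , (_ , _ , q′≤Y)) = ℕP.<⇒≢ p<p′ , ℕP.<⇒≢ (below p≤X q′≤Y)
      fromQ : ∀ {x} → (p , q) ⊏ x × InBox X Y x → let (p′ , q′) = x in n ∸ q ≢ p′ × n ∸ q ≢ n ∸ q′
      fromQ ((_ , q<q′) , (p′≤X , _ , q′≤Y)) =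
        ℕP.>⇒≢ (below p′≤X q≤Y) ,
        ℕP.>⇒≢ (ℕP.∸-monoʳ-< q<q′ (ℕP.≤-trans q′≤Y (ℕP.≤-trans (ℕP.m≤n+m Y X) (ℕP.<⇒≤ X+Y<n))))

  -- The vertices of C'(S_{d,i})

  k≤2k∸1 : ∀ k → k ≤ 2 * k ∸ 1
  k≤2k∸1 zero    = z≤n
  k≤2k∸1 (suc k) = subst (suc k ≤_) (sym (ℕP.+-suc k (k + 0))) (s≤s (ℕP.m≤m+n k (k + 0)))

  module Vertices (k N D I : ℕ) {j : ℕ} where

    cEven-low : j ≤ k → cEven k N (+ D) j ≡ + (j * D)
    cEven-low j≤k with j ℕ.≤ᵇ k | ℕP.≤⇒≤ᵇ j≤k
    ... | true | _ = sym (ℤP.pos-* j D)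

    cEven-mid : k < j → j ≤ 2 * k ∸ 1 → cEven k N (+ D) j ≡ + ((j + 1) * D)
    cEven-mid k<j j≤2k∸1 with j ℕ.≤ᵇ k | ℕP.≤ᵇ⇒≤ j k | j ℕ.≤ᵇ (2 * k ∸ 1) | ℕP.≤⇒≤ᵇ j≤2k∸1
    ... | true  | j≤k | _    | _ = ⊥-elim (ℕP.<⇒≱ k<j (j≤k _))
    ... | false | _   | true | _ = sym (ℤP.pos-* (j + 1) D)

    cEven-high : 2 * k ∸ 1 < j → cEven k N (+ D) j ≡ + half k N - + (2 * k + 1) ℤ.* + D
    cEven-high 2k∸1<j with j ℕ.≤ᵇ k | ℕP.≤ᵇ⇒≤ j k | j ℕ.≤ᵇ (2 * k ∸ 1) | ℕP.≤ᵇ⇒≤ j (2 * k ∸ 1)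
    ... | true  | j≤k | _     | _      = ⊥-elim (ℕP.<⇒≱ 2k∸1<j (ℕP.≤-trans (j≤k _) (k≤2k∸1 k)))
    ... | false | _   | true  | j≤2k∸1 = ⊥-elim (ℕP.<⇒≱ 2k∸1<j (j≤2k∸1 _))
    ... | false | _   | false | _      = refl

    cOdd-low : j ≤ 2 * k ∸ 1 → cOdd k (+ D) (+ I) j ≡ - + (j * D + I)
    cOdd-low j≤2k∸1 with j ℕ.≤ᵇ (2 * k ∸ 1) | ℕP.≤⇒≤ᵇ j≤2k∸1
    ... | true | _ =
      trans (cong (λ x → - x - + I) (sym (ℤP.pos-* j D))) (sym (ℤP.neg-distrib-+ (+ (j * D)) (+ I)))

    cOdd-high : 2 * k ∸ 1 < j → cOdd k (+ D) (+ I) j ≡ - + ((2 * k + 1) * D + I)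
    cOdd-high 2k∸1<j with j ℕ.≤ᵇ (2 * k ∸ 1) | ℕP.≤ᵇ⇒≤ j (2 * k ∸ 1)
    ... | true  | j≤2k∸1 = ⊥-elim (ℕP.<⇒≱ 2k∸1<j (j≤2k∸1 _))
    ... | false | _      = trans (cong (λ x → - x - + I) (sym (ℤP.pos-* (2 * k + 1) D)))
                                 (sym (ℤP.neg-distrib-+ (+ ((2 * k + 1) * D)) (+ I)))

  module Blocks (D I : ℕ) where

    block : ℕ → ℕ → ℕ → List (ℕ × ℕ)
    block a b m = applyUpTo (λ j → ((a + j) * D , (b + j) * D + I)) m

    block-suc : ∀ a b m → block a b (suc m) ≡ (a * D , b * D + I) ∷ block (suc a) (suc b) m
    block-suc a b m = cong₂ _∷_ (cong₂ pair (ℕP.+-identityʳ a) (ℕP.+-identityʳ b))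
                                (applyUpTo-cong m (λ {j} _ → cong₂ pair (ℕP.+-suc a j) (ℕP.+-suc b j)))
      where
      pair : ℕ → ℕ → ℕ × ℕ
      pair x y = (x * D , y * D + I)

    adjacentSums-block : ∀ a b m → adjacentSums (b * D + I) (block a (suc b) m)
      ≡ applyUpTo (λ t → (a + b + t) * D + I) (m + m)
    adjacentSums-block a b zero    = refl
    adjacentSums-block a b (suc m) = begin
      adjacentSums (b * D + I) (block a (suc b) (suc m))
        ≡⟨ cong (adjacentSums (b * D + I)) (block-suc a (suc b) m) ⟩
      a * D + (b * D + I) ∷ a * D + (suc b * D + I)
        ∷ adjacentSums (suc b * D + I) (block (suc a) (suc (suc b)) m)
        ≡⟨ cong₂ _∷_ (first a b D I) (cong₂ _∷_ (second a b D I) (trans (adjacentSums-block (suc a) (suc b) m)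
             (applyUpTo-cong (m + m) (λ {t} _ → cong (λ x → x * D + I) (shift a b t))))) ⟩
      applyUpTo (λ t → (a + b + t) * D + I) (2 + (m + m))
        ≡⟨ cong (applyUpTo λ t → (a + b + t) * D + I) (cong suc (ℕP.+-suc m m)) ⟨
      applyUpTo (λ t → (a + b + t) * D + I) (suc m + suc m)
        ∎
      where
      open ≡-Reasoning
      first : ∀ a b D I → a * D + (b * D + I) ≡ (a + b + 0) * D + I
      first = solve-∀
      second : ∀ a b D I → a * D + (suc b * D + I) ≡ (a + b + 1) * D + I
      second = solve-∀
      shift : ∀ a b t → suc a + suc b + t ≡ a + b + suc (suc t)
      shift = solve-∀

    lastSnd-block : ∀ a b m → lastSnd (b * D + I) (block a (suc b) m) ≡ (b + m) * D + I
    lastSnd-block a b zero    = cong (λ x → x * D + I) (sym (ℕP.+-identityʳ b))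
    lastSnd-block a b (suc m) = begin
      lastSnd (b * D + I) (block a (suc b) (suc m))
        ≡⟨ cong (lastSnd (b * D + I)) (block-suc a (suc b) m) ⟩
      lastSnd (suc b * D + I) (block (suc a) (suc (suc b)) m)
        ≡⟨ lastSnd-block (suc a) (suc b) m ⟩
      (suc b + m) * D + I
        ≡⟨ cong (λ x → x * D + I) (ℕP.+-suc b m) ⟨
      (b + suc m) * D + I
        ∎
      where open ≡-Reasoning

    module _ .{{_ : NonZero D}} where

      block-element-⊏ : ∀ a b {m i p q} → i < m → (a + m) * D ≤ p → (b + m) * D + I ≤ q
        → ((a + i) * D , (b + i) * D + I) ⊏ (p , q)
      block-element-⊏ a b i<m a+m≤p b+m≤q =
        ℕP.<-≤-trans (ℕP.*-monoˡ-< D (ℕP.+-monoʳ-< a i<m)) a+m≤p ,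
        ℕP.<-≤-trans (ℕP.+-monoˡ-< I (ℕP.*-monoˡ-< D (ℕP.+-monoʳ-< b i<m))) b+m≤q

      block-increasing : ∀ a b m → AllPairs _⊏_ (block a b m)
      block-increasing a b m =
        AllPairsP.applyUpTo⁺₁ _ m (λ i<j _ → block-element-⊏ a b i<j ℕP.≤-refl ℕP.≤-refl)

      block-⊏ : ∀ a b m {p q} → (a + m) * D ≤ p → (b + m) * D + I ≤ q → All (_⊏ (p , q)) (block a b m)
      block-⊏ a b m a+m≤p b+m≤q = AllP.applyUpTo⁺₁ _ m (λ i<m → block-element-⊏ a b i<m a+m≤p b+m≤q)

      block-⊏-block : ∀ a b m {a′ b′} m′ → a + m ≤ a′ → b + m ≤ b′
        → All (λ x → All (x ⊏_) (block a′ b′ m′)) (block a b m)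
      block-⊏-block a b m {a′} {b′} m′ a+m≤a′ b+m≤b′ = AllP.applyUpTo⁺₁ _ m λ i<m →
        AllP.applyUpTo⁺₁ _ m′ λ {j} _ →
          block-element-⊏ a b i<m (ℕP.*-monoˡ-≤ D (ℕP.≤-trans a+m≤a′ (ℕP.m≤m+n a′ j)))
                                  (ℕP.+-monoˡ-≤ I (ℕP.*-monoˡ-≤ D (ℕP.≤-trans b+m≤b′ (ℕP.m≤m+n b′ j))))

      block-inBox : ∀ a b m {X Y} → 1 ≤ I → (a + m) * D ≤ X → (b + m) * D + I ≤ Y
        → All (InBox X Y) (block a b m)
      block-inBox a b m 1≤I a+m≤X b+m≤Y = AllP.applyUpTo⁺₁ _ m λ {i} i<m →
        let (p<X , q<Y) = block-element-⊏ a b i<m a+m≤X b+m≤Y in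
        ℕP.<⇒≤ p<X , ℕP.≤-trans 1≤I (ℕP.m≤n+m I ((b + i) * D)) , ℕP.<⇒≤ q<Y

  -- The construction, for k = k′ + 1, i = I′ + 1, d = i + F and N = d + 2e

  module Construction (k′ I′ F E : ℕ) where

    k I D N : ℕ
    k = suc k′
    I = suc I′
    D = I + F
    N = D + 2 * E

    open Blocks D I
    open Vertices k N D I

    progression : ℕ → ℕ
    progression t = t * D + I

    X Y : ℕ
    X = (2 * k + 1) * D + (8 * k + 4) * E
    Y = progression (2 * k + 1)

    lowPairs highPairs : List (ℕ × ℕ)
    lowPairs  = block 0 0 (suc k)
    highPairs = block (suc (suc k)) (suc k) k′

    -- The pairs (c_{2j} , −c_{2j+1}) for j ≤ k, for k < j < 2k, and for j = 2k.
    pairs : List (ℕ × ℕ)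
    pairs = lowPairs ++ highPairs ++ [ (X , Y) ]

    2k∸1≡k+k′ : 2 * k ∸ 1 ≡ k + k′
    2k∸1≡k+k′ = lemma k′
      where
      lemma : ∀ k′ → k′ + suc (k′ + 0) ≡ suc k′ + k′
      lemma = solve-∀

    2k+1≡k+2+k′ : 2 * k + 1 ≡ suc (suc k) + k′
    2k+1≡k+2+k′ = lemma k′
      where
      lemma : ∀ k′ → 2 * suc k′ + 1 ≡ suc (suc (suc k′)) + k′
      lemma = solve-∀

    cEven-X : + half k N - + (2 * k + 1) ℤ.* + D ≡ + X
    cEven-X = begin
      + half k N - + c ℤ.* + D         ≡⟨ cong₂ _-_ (cong +_ (half≡ k D E)) (sym (ℤP.pos-* c D)) ⟩
      (+ X ℤ.+ + (c * D)) - + (c * D)  ≡⟨ cancel (+ X) (+ (c * D)) ⟩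
      + X                              ∎
      where
      open ≡-Reasoning
      c = 2 * k + 1
      half≡ : ∀ k D E → (4 * k + 2) * (D + 2 * E) ≡ ((2 * k + 1) * D + (8 * k + 4) * E) + (2 * k + 1) * D
      half≡ = solve-∀
      cancel : ∀ x y → (x ℤ.+ y) - y ≡ x
      cancel = ℤSolver.solve-∀

    C'≡zigzag : C' k N (+ D) (+ I) ≡ zigzag pairs
    C'≡zigzag = begin
      concatMap vertexPair (upTo (2 * k + 1))
        ≡⟨ cong (concatMap vertexPair) indices ⟩
      concatMap vertexPair (upTo (suc k) ++ middleIndices ∷ʳ (suc k + k′))
        ≡⟨ concatMap-++ vertexPair (upTo (suc k)) _ ⟩
      concatMap vertexPair (upTo (suc k)) ++ concatMap vertexPair (middleIndices ∷ʳ (suc k + k′))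
        ≡⟨ cong (concatMap vertexPair (upTo (suc k)) ++_) (concatMap-++ vertexPair middleIndices _) ⟩
      concatMap vertexPair (upTo (suc k)) ++ concatMap vertexPair middleIndices ++ vertexPair (suc k + k′) ++ []
        ≡⟨ cong₂ _++_ (concatMap-applyUpTo-cong vertexPair signedPair {f₁ = id} (suc k) low)
             (cong₂ _++_ (concatMap-applyUpTo-cong vertexPair signedPair k′ middle) (cong (_++ []) high)) ⟩
      zigzag lowPairs ++ zigzag highPairs ++ zigzag [ (X , Y) ]
        ≡⟨ trans (concatMap-++ signedPair lowPairs _)
                 (cong (zigzag lowPairs ++_) (concatMap-++ signedPair highPairs _)) ⟨
      zigzag pairs
        ∎
      where
      open ≡-Reasoning
      vertexPair : ℕ → List ℤ
      vertexPair j = cEven k N (+ D) j ∷ cOdd k (+ D) (+ I) j ∷ []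
      middleIndices : List ℕ
      middleIndices = applyUpTo (λ j → suc k + j) k′
      indices : upTo (2 * k + 1) ≡ upTo (suc k) ++ middleIndices ∷ʳ (suc k + k′)
      indices = begin
        upTo (2 * k + 1)                                   ≡⟨ cong upTo (trans 2k+1≡k+2+k′ (sym (ℕP.+-suc (suc k) k′))) ⟩
        upTo (suc k + suc k′)                              ≡⟨ applyUpTo-+ id (suc k) (suc k′) ⟩
        upTo (suc k) ++ applyUpTo (λ j → suc k + j) (suc k′) ≡⟨ cong (upTo (suc k) ++_) (applyUpTo-∷ʳ _ k′) ⟨
        upTo (suc k) ++ middleIndices ∷ʳ (suc k + k′)      ∎
      low : ∀ {j} → j < suc k → vertexPair j ≡ signedPair (j * D , j * D + I)
      low (s≤s j≤k) = cong₂ _∷_ (cEven-low j≤k) (cong [_] (cOdd-low (ℕP.≤-trans j≤k (k≤2k∸1 k))))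
      middle : ∀ {j} → j < k′ → vertexPair (suc k + j) ≡ signedPair ((suc (suc k) + j) * D , (suc k + j) * D + I)
      middle {j} j<k′ = cong₂ _∷_
        (trans (cEven-mid (s≤s (ℕP.m≤m+n k j)) inRange) (cong (λ x → + (x * D)) (ℕP.+-comm (suc k + j) 1)))
        (cong [_] (cOdd-low inRange))
        where
        inRange : suc k + j ≤ 2 * k ∸ 1
        inRange = subst (suc k + j ≤_) (sym 2k∸1≡k+k′) (subst (_≤ k + k′) (ℕP.+-suc k j) (ℕP.+-monoʳ-≤ k j<k′))
      high : vertexPair (suc k + k′) ≡ signedPair (X , Y)
      high = cong₂ _∷_ (trans (cEven-high beyond) cEven-X) (cong [_] (cOdd-high beyond))
        where
        beyond : 2 * k ∸ 1 < suc k + k′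
        beyond = subst (_< suc k + k′) (sym 2k∸1≡k+k′) ℕP.≤-refl

    half∸I extra₁ extra₂ : ℕ
    half∸I = (4 * k + 1) * I + (4 * k + 2) * F + (8 * k + 4) * E
    extra₁ = 4 * k * N + 4 * E + I
    extra₂ = half∸I + 1

    half≡half∸I+I : half k N ≡ half∸I + I
    half≡half∸I+I = lemma k I F E
      where
      lemma : ∀ k I F E → (4 * k + 2) * (I + F + 2 * E) ≡ (4 * k + 1) * I + (4 * k + 2) * F + (8 * k + 4) * E + I
      lemma = solve-∀

    half≡extra₁+I+2F : half k N ≡ extra₁ + (I + 2 * F)
    half≡extra₁+I+2F = lemma k I F E
      where
      lemma : ∀ k I F E → (4 * k + 2) * (I + F + 2 * E) ≡ 4 * k * (I + F + 2 * E) + 4 * E + I + (I + 2 * F)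
      lemma = solve-∀

    X+Y≡half+I : X + Y ≡ half k N + I
    X+Y≡half+I = lemma k I F E
      where
      lemma : ∀ k I F E → ((2 * k + 1) * (I + F) + (8 * k + 4) * E) + ((2 * k + 1) * (I + F) + I)
        ≡ (4 * k + 2) * (I + F + 2 * E) + I
      lemma = solve-∀

    order≡extra₂+[X+Y] : order k N ≡ extra₂ + (X + Y)
    order≡extra₂+[X+Y] = lemma k I F E
      where
      lemma : ∀ k I F E → suc ((8 * k + 4) * (I + F + 2 * E))
        ≡ ((4 * k + 1) * I + (4 * k + 2) * F + (8 * k + 4) * E + 1)
          + (((2 * k + 1) * (I + F) + (8 * k + 4) * E) + ((2 * k + 1) * (I + F) + I))
      lemma = solve-∀

    X+Y<order : X + Y < order k N
    X+Y<order = subst (X + Y <_) (sym order≡extra₂+[X+Y]) (ℕP.m<n+m (X + Y) (s≤s z≤n))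

    X+q≡extra₁ : X + ((k + k′) * D + I) ≡ extra₁
    X+q≡extra₁ = lemma k′ I F E
      where
      lemma : ∀ k′ I F E → (2 * suc k′ + 1) * (I + F) + (8 * suc k′ + 4) * E + ((suc k′ + k′) * (I + F) + I)
        ≡ 4 * suc k′ * (I + F + 2 * E) + 4 * E + I
      lemma = solve-∀

    4k≡[2k+1]+[2k-1] : 4 * k ≡ suc (k + k) + suc (k′ + k′)
    4k≡[2k+1]+[2k-1] = lemma k′
      where
      lemma : ∀ k′ → 4 * suc k′ ≡ suc (suc k′ + suc k′) + suc (k′ + k′)
      lemma = solve-∀

    progression≤half : ∀ {t} → t < 4 * k → progression t ≤ half k N
    progression≤half {t} t<4k = begin
      t * D + I  ≤⟨ ℕP.+-monoʳ-≤ (t * D) (ℕP.m≤m+n I F) ⟩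
      t * D + D  ≡⟨ ℕP.+-comm (t * D) D ⟩
      suc t * D  ≤⟨ ℕP.*-monoˡ-≤ D t<4k ⟩
      4 * k * D  ≤⟨ ℕP.*-mono-≤ (ℕP.m≤m+n (4 * k) 2) (ℕP.m≤m+n D (2 * E)) ⟩
      half k N   ∎
      where open ℕP.≤-Reasoning

    edgeLength-progression : ∀ {t} → t < 4 * k → edgeLength k N (progression t) ≡ progression t
    edgeLength-progression {t} t<4k =
      edgeLength-≤half {k} {N} (ℕP.≤-trans (s≤s z≤n) (ℕP.m≤n+m I (t * D))) (progression≤half t<4k)

    map-edgeLength-progression : ∀ {f : ℕ → ℕ} m → (∀ {t} → t < m → f t < 4 * k)
      → map (edgeLength k N) (applyUpTo (progression ∘ f) m) ≡ applyUpTo (progression ∘ f) m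
    map-edgeLength-progression {f} m f<4k =
      trans (map-applyUpTo (progression ∘ f) (edgeLength k N) m) (applyUpTo-cong m (edgeLength-progression ∘ f<4k))

    lowSums highSums : List ℕ
    lowSums  = applyUpTo progression (suc (k + k))
    highSums = applyUpTo (λ t → progression (suc (suc k) + k + t)) (k′ + k′)

    rest : List (ℕ × ℕ)
    rest = block 1 1 k ++ highPairs ++ [ (X , Y) ]

    adjacentSums-rest :
      adjacentSums I rest ≡ applyUpTo (progression ∘ suc) (k + k) ++ highSums ++ extra₁ ∷ X + Y ∷ []
    adjacentSums-rest = begin
      adjacentSums I rest
        ≡⟨ adjacentSums-++ I (block 1 1 k) _ ⟩
      adjacentSums I (block 1 1 k) ++ adjacentSums (lastSnd I (block 1 1 k)) (highPairs ++ [ (X , Y) ])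
        ≡⟨ cong₂ (λ s q → s ++ adjacentSums q (highPairs ++ [ (X , Y) ]))
                 (adjacentSums-block 1 0 k) (lastSnd-block 1 0 k) ⟩
      applyUpTo (progression ∘ suc) (k + k) ++ adjacentSums (k * D + I) (highPairs ++ [ (X , Y) ])
        ≡⟨ cong (applyUpTo (progression ∘ suc) (k + k) ++_) (adjacentSums-++ (k * D + I) highPairs _) ⟩
      applyUpTo (progression ∘ suc) (k + k) ++ adjacentSums (k * D + I) highPairs
        ++ X + lastSnd (k * D + I) highPairs ∷ X + Y ∷ []
        ≡⟨ cong₂ (λ s x → applyUpTo (progression ∘ suc) (k + k) ++ s ++ x ∷ X + Y ∷ [])
                 (adjacentSums-block (suc (suc k)) k k′)
                 (trans (cong (_+_ X) (lastSnd-block (suc (suc k)) k k′)) X+q≡extra₁) ⟩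
      applyUpTo (progression ∘ suc) (k + k) ++ highSums ++ extra₁ ∷ X + Y ∷ []
        ∎
      where open ≡-Reasoning

    lastSnd-rest : lastSnd I rest ≡ Y
    lastSnd-rest = trans (lastSnd-++ I (block 1 1 k) _) (lastSnd-++ _ highPairs [ (X , Y) ])

    diffList-pairs :
      diffList k N (zigzag pairs) ≡ map (edgeLength k N) (lowSums ++ highSums ++ extra₁ ∷ X + Y ∷ Y ∷ [])
    diffList-pairs = begin
      diffList k N (zigzag ((0 , I) ∷ rest))
        ≡⟨ diffList-zigzag k N 0 I rest ⟩
      map (edgeLength k N) (I ∷ adjacentSums I rest ∷ʳ lastSnd I rest)
        ≡⟨ cong₂ (λ s q → map (edgeLength k N) (I ∷ s ∷ʳ q)) adjacentSums-rest lastSnd-rest ⟩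
      map (edgeLength k N) (I ∷ (applyUpTo (progression ∘ suc) (k + k) ++ highSums ++ extra₁ ∷ X + Y ∷ []) ∷ʳ Y)
        ≡⟨ cong (λ s → map (edgeLength k N) (I ∷ s))
                (trans (++-assoc (applyUpTo (progression ∘ suc) (k + k)) _ [ Y ])
                       (cong (applyUpTo (progression ∘ suc) (k + k) ++_) (++-assoc highSums _ [ Y ]))) ⟩
      map (edgeLength k N) (lowSums ++ highSums ++ extra₁ ∷ X + Y ∷ Y ∷ [])
        ∎
      where open ≡-Reasoning

    4k≡2k+2+[k′+k′] : 4 * k ≡ suc (suc k) + k + (k′ + k′)
    4k≡2k+2+[k′+k′] = lemma k′
      where
      lemma : ∀ k′ → 4 * suc k′ ≡ suc (suc (suc k′)) + suc k′ + (k′ + k′)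
      lemma = solve-∀

    2k+1<4k : 2 * k + 1 < 4 * k
    2k+1<4k = subst (2 * k + 1 <_) (sym 4k≡2k+2+[k′+k′])
                    (ℕP.≤-trans (ℕP.≤-reflexive (lemma k′)) (ℕP.m≤m+n (suc (suc k) + k) (k′ + k′)))
      where
      lemma : ∀ k′ → suc (2 * suc k′ + 1) ≡ suc (suc (suc k′)) + suc k′
      lemma = solve-∀

    edgeLength-extra₁ : edgeLength k N extra₁ ≡ extra₁
    edgeLength-extra₁ = edgeLength-≤half {k} {N} (ℕP.≤-trans (s≤s z≤n) (ℕP.m≤n+m I (4 * k * N + 4 * E)))
                          (subst (extra₁ ≤_) (sym half≡extra₁+I+2F) (ℕP.m≤m+n extra₁ (I + 2 * F)))

    edgeLength-X+Y : edgeLength k N (X + Y) ≡ extra₂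
    edgeLength-X+Y = begin
      edgeLength k N (X + Y)          ≡⟨ edgeLength->half {k} {N} half<X+Y X+Y<order ⟩
      order k N ∸ (X + Y)             ≡⟨ cong (_∸ (X + Y)) order≡extra₂+[X+Y] ⟩
      extra₂ + (X + Y) ∸ (X + Y)      ≡⟨ ℕP.m+n∸n≡m extra₂ (X + Y) ⟩
      extra₂                          ∎
      where
      open ≡-Reasoning
      half<X+Y : half k N < X + Y
      half<X+Y = subst (half k N <_) (sym X+Y≡half+I)
                       (subst (_≤ half k N + I) (ℕP.+-comm (half k N) 1) (ℕP.+-monoʳ-≤ (half k N) (s≤s z≤n)))

    map-edgeLength-sums : map (edgeLength k N) (lowSums ++ highSums ++ extra₁ ∷ X + Y ∷ Y ∷ [])
      ≡ lowSums ++ highSums ++ extra₁ ∷ extra₂ ∷ Y ∷ []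
    map-edgeLength-sums = begin
      map (edgeLength k N) (lowSums ++ highSums ++ extra₁ ∷ X + Y ∷ Y ∷ [])
        ≡⟨ trans (map-++ (edgeLength k N) lowSums _)
                 (cong (map (edgeLength k N) lowSums ++_) (map-++ (edgeLength k N) highSums _)) ⟩
      map (edgeLength k N) lowSums ++ map (edgeLength k N) highSums ++ map (edgeLength k N) (extra₁ ∷ X + Y ∷ Y ∷ [])
        ≡⟨ cong₂ _++_ (map-edgeLength-progression {id} (suc (k + k)) low<4k)
             (cong₂ _++_ (map-edgeLength-progression (k′ + k′) high<4k)
               (cong₂ _∷_ edgeLength-extra₁ (cong₂ _∷_ edgeLength-X+Y (cong [_] (edgeLength-progression 2k+1<4k))))) ⟩
      lowSums ++ highSums ++ extra₁ ∷ extra₂ ∷ Y ∷ []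
        ∎
      where
      open ≡-Reasoning
      low<4k : ∀ {t} → t < suc (k + k) → t < 4 * k
      low<4k {t} t<2k+1 = subst (t <_) (sym 4k≡[2k+1]+[2k-1]) (ℕP.<-≤-trans t<2k+1 (ℕP.m≤m+n _ _))
      high<4k : ∀ {t} → t < k′ + k′ → suc (suc k) + k + t < 4 * k
      high<4k {t} t<2k-2 =
        subst (suc (suc k) + k + t <_) (sym 4k≡2k+2+[k′+k′]) (ℕP.+-monoʳ-< (suc (suc k) + k) t<2k-2)

    progressions≡ : applyUpTo progression (4 * k) ≡ lowSums ++ Y ∷ highSums
    progressions≡ = begin
      applyUpTo progression (4 * k)
        ≡⟨ cong (applyUpTo progression) 4k≡[2k+1]+[2k-1] ⟩
      applyUpTo progression (suc (k + k) + suc (k′ + k′))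
        ≡⟨ applyUpTo-+ progression (suc (k + k)) (suc (k′ + k′)) ⟩
      lowSums ++ progression (suc (k + k) + 0) ∷ applyUpTo (λ t → progression (suc (k + k) + suc t)) (k′ + k′)
        ≡⟨ cong (lowSums ++_) (cong₂ _∷_ (cong progression (middle k))
                                          (applyUpTo-cong (k′ + k′) (λ {t} _ → cong progression (shift k t)))) ⟩
      lowSums ++ Y ∷ highSums
        ∎
      where
      open ≡-Reasoning
      middle : ∀ k → suc (k + k) + 0 ≡ 2 * k + 1
      middle = solve-∀
      shift : ∀ k t → suc (k + k) + suc t ≡ suc (suc k) + k + t
      shift = solve-∀

    S≡ : S k N (+ D) (+ E) (+ I) ≡ map (+_) (applyUpTo progression (4 * k) ++ extra₁ ∷ extra₂ ∷ [])
    S≡ = sym (trans (map-++ (+_) (applyUpTo progression (4 * k)) _)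
                    (cong₂ _++_ (trans (map-applyUpTo progression (+_) (4 * k))
                                       (applyUpTo-cong (4 * k) λ {j} _ → cong (ℤ._+ + I) (ℤP.pos-* j D)))
                                (cong₂ _∷_ (cong (λ x → + (4 * k * N) ℤ.+ x ℤ.+ + I) (ℤP.pos-* 4 E))
                                           (cong [_] extra₂≡))))
      where
      cancel : ∀ x y → (x ℤ.+ y) - y ≡ x
      cancel = ℤSolver.solve-∀
      extra₂≡ : + extra₂ ≡ + half k N - + I ℤ.+ + 1
      extra₂≡ = cong (ℤ._+ + 1)
        (trans (sym (cancel (+ half∸I) (+ I))) (cong (λ h → + h - + I) (sym half≡half∸I+I)))

    diffs↭S : map (+_) (diffList k N (C' k N (+ D) (+ I))) ↭ S k N (+ D) (+ E) (+ I)
    diffs↭S = begin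
      map (+_) (diffList k N (C' k N (+ D) (+ I)))
        ≡⟨ cong (map (+_) ∘ diffList k N) C'≡zigzag ⟩
      map (+_) (diffList k N (zigzag pairs))
        ≡⟨ cong (map (+_)) (trans diffList-pairs map-edgeLength-sums) ⟩
      map (+_) (lowSums ++ highSums ++ (extra₁ ∷ extra₂ ∷ []) ∷ʳ Y)
        ↭⟨ ↭P.map⁺ (+_) (∷ʳ-↭-insert lowSums highSums (extra₁ ∷ extra₂ ∷ []) Y) ⟩
      map (+_) ((lowSums ++ Y ∷ highSums) ++ extra₁ ∷ extra₂ ∷ [])
        ≡⟨ cong (λ xs → map (+_) (xs ++ extra₁ ∷ extra₂ ∷ [])) progressions≡ ⟨
      map (+_) (applyUpTo progression (4 * k) ++ extra₁ ∷ extra₂ ∷ [])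
        ≡⟨ S≡ ⟨
      S k N (+ D) (+ E) (+ I)
        ∎
      where open PermutationReasoning

    ≤X : ∀ {c} → c ≤ 2 * k + 1 → c * D ≤ X
    ≤X c≤2k+1 = ℕP.≤-trans (ℕP.*-monoˡ-≤ D c≤2k+1) (ℕP.m≤m+n _ _)

    ≤Y : ∀ {c} → c ≤ 2 * k + 1 → c * D + I ≤ Y
    ≤Y c≤2k+1 = ℕP.+-monoˡ-≤ I (ℕP.*-monoˡ-≤ D c≤2k+1)

    k+2+k′≤2k+1 : suc (suc k) + k′ ≤ 2 * k + 1
    k+2+k′≤2k+1 = ℕP.≤-reflexive (sym 2k+1≡k+2+k′)

    k+1+k′≤2k+1 : suc k + k′ ≤ 2 * k + 1
    k+1+k′≤2k+1 = ℕP.≤-trans (ℕP.n≤1+n (suc k + k′)) k+2+k′≤2k+1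

    k+1≤2k+1 : suc k ≤ 2 * k + 1
    k+1≤2k+1 = ℕP.≤-trans (ℕP.m≤m+n (suc k) k′) k+1+k′≤2k+1

    pairs-increasing : AllPairs _⊏_ pairs
    pairs-increasing = AllPairsP.++⁺ (block-increasing 0 0 (suc k))
      (AllPairsP.++⁺ (block-increasing (suc (suc k)) (suc k) k′) ([] ∷ [])
                     (All.map (_∷ []) (block-⊏ (suc (suc k)) (suc k) k′ (≤X k+2+k′≤2k+1) (≤Y k+1+k′≤2k+1))))
      (All.zipWith (λ (⊏highPairs , ⊏XY) → AllP.++⁺ ⊏highPairs (⊏XY ∷ []))
                   (block-⊏-block 0 0 (suc k) k′ (ℕP.n≤1+n (suc k)) ℕP.≤-refl ,
                    block-⊏ 0 0 (suc k) (≤X k+1≤2k+1) (≤Y k+1≤2k+1)))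

    pairs-inBox : All (InBox X Y) pairs
    pairs-inBox = AllP.++⁺ (block-inBox 0 0 (suc k) (s≤s z≤n) (≤X k+1≤2k+1) (≤Y k+1≤2k+1))
      (AllP.++⁺ (block-inBox (suc (suc k)) (suc k) k′ (s≤s z≤n) (≤X k+2+k′≤2k+1) (≤Y k+1+k′≤2k+1))
                ((ℕP.≤-refl , ℕP.≤-trans (s≤s z≤n) (ℕP.m≤n+m I ((2 * k + 1) * D)) , ℕP.≤-refl) ∷ []))

    isCycle : IsCycle k N (C' k N (+ D) (+ I))
    isCycle = subst (IsCycle k N) (sym C'≡zigzag)
      (s≤s (s≤s (s≤s z≤n)) ,
       subst Unique (sym (map-res-zigzag {k} {N} X+Y<order pairs-inBox))
                    (residues-unique X+Y<order pairs-increasing pairs-inBox))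

  construction : ∀ k′ I′ F E {D N} → suc I′ + F ≡ D → D + 2 * E ≡ N
    → IsCycle (suc k′) N (C' (suc k′) N (+ D) (+ suc I′))
    × map (+_) (diffList (suc k′) N (C' (suc k′) N (+ D) (+ suc I′))) ↭ S (suc k′) N (+ D) (+ E) (+ suc I′)
  construction k′ I′ F E refl refl = isCycle , diffs↭S
    where open Construction k′ I′ F E

  gcd-pos : ∀ (a : ℤ) (b : ℕ) .{{_ : NonZero b}} → ℤ.Positive (gcd a (+ b))
  gcd-pos a (suc b) = ℤ.positive (ℤ.+<+ (ℕP.n≢0⇒n>0 (ℕGCD.gcd[m,n]≢0 ℤ.∣ a ∣ (suc b) (inj₂ λ ()))))

  /-<⇒*-< : ∀ (a c : ℤ) (b e : ℕ) .{{_ : NonZero b}} .{{_ : NonZero e}}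
    → (a / b) ℚ.< (c / e) → a ℤ.* + e ℤ.< c ℤ.* + b
  /-<⇒*-< a c b e (ℚ.*<* lt) =
    subst₂ ℤ._<_ (trans (swap₁ (↥ (a / b)) (↧ (c / e)) g₁ g₂) (cong₂ ℤ._*_ (ℚP.↥-/ a b) (ℚP.↧-/ c e)))
                 (trans (swap₂ (↥ (c / e)) (↧ (a / b)) g₁ g₂) (cong₂ ℤ._*_ (ℚP.↥-/ c e) (ℚP.↧-/ a b)))
                 (ℤP.*-monoʳ-<-pos g₂ {{gcd-pos c e}} (ℤP.*-monoʳ-<-pos g₁ {{gcd-pos a b}} lt))
    where
    g₁ = gcd a (+ b)
    g₂ = gcd c (+ e)
    swap₁ : ∀ x y u v → ((x ℤ.* y) ℤ.* u) ℤ.* v ≡ (x ℤ.* u) ℤ.* (y ℤ.* v)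
    swap₁ = ℤSolver.solve-∀
    swap₂ : ∀ x y u v → ((x ℤ.* y) ℤ.* u) ℤ.* v ≡ (x ℤ.* v) ℤ.* (y ℤ.* u)
    swap₂ = ℤSolver.solve-∀

lemma14 : (k N : ℕ) → 1 ℕ.≤ k → 1 ℕ.≤ N → (d : ℤ) → (+ 2) ∣ (d - + N)
    → ((+ N / 3) ℚ.- (+ N / (15 ℕ.+ 48 ℕ.* k))) ℚ.< (d / 1) → (d / 1) ℚ.< (+ N / 3)
    → (e : ℤ) → + N - d ≡ + 2 ℤ.* e
    → (i : ℤ) → + 1 ℤ.≤ i → i ℤ.≤ d
    → IsCycle k N (C' k N d i) × (map +_ (diffList k N (C' k N d i)) ↭ S k N d e i)
lemma14 (ℕ.suc k′) N _ _ (+ D) _ _ _ (+ E) N-D≡2E (+ ℕ.suc I′) (ℤ.+≤+ (ℕ.s≤s ℕ.z≤n)) (ℤ.+≤+ I≤D) =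
  construction k′ I′ (D ℕ.∸ ℕ.suc I′) E (ℕP.m+[n∸m]≡n I≤D) D+2E≡N
  where
  recover : ∀ a b → a ≡ (a - b) ℤ.+ b
  recover = ℤSolver.solve-∀
  D+2E≡N : D ℕ.+ 2 ℕ.* E ≡ N
  D+2E≡N = trans (ℕP.+-comm D (2 ℕ.* E)) (sym (ℤP.+-injective
    (trans (recover (+ N) (+ D)) (cong (ℤ._+ + D) (trans N-D≡2E (sym (ℤP.pos-* 2 E)))))))
lemma14 (ℕ.suc k′) N _ _ (+ D) _ _ d<N/3 ℤ.-[1+ m ] N-D≡2e _ _ _ =
  ⊥-elim (nonNeg≢neg (trans (sym N-D≡N∸D) N-D≡2e))
  where
  nonNeg≢neg : ∀ {a} → + a ≢ + 2 ℤ.* ℤ.-[1+ m ]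
  nonNeg≢neg ()
  3D<N : D ℕ.* 3 ℕ.< N ℕ.* 1
  3D<N = ℤP.drop‿+<+ (subst₂ ℤ._<_ (sym (ℤP.pos-* D 3)) (sym (ℤP.pos-* N 1)) (/-<⇒*-< (+ D) (+ N) 1 3 d<N/3))
  D≤N : D ℕ.≤ N
  D≤N = ℕP.≤-trans (ℕP.m≤m*n D 3) (ℕP.≤-trans (ℕP.<⇒≤ 3D<N) (ℕP.≤-reflexive (ℕP.*-identityʳ N)))
  N-D≡N∸D : + N - + D ≡ + (N ℕ.∸ D)
  N-D≡N∸D = trans (ℤP.m-n≡m⊖n N D) (ℤP.⊖-≥ D≤N)
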